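{- For nonnegative integers $n$ and $r$ and any $y$, \[ \tilde{w}_{n,r}(y)-(r+1)\tilde{w}_{n,r+1}(y)=\frac{y^{r}}{r!}\sum_{i=0}^{r}(-1)^{r-i}\binom{r}{i}\phi_{n,i}(-y). \]
   Context: ${n\brace k}$ denotes the Stirling number of the second kind. For $s\ge0$, ${n+s\brace k+s}_s$ is the $s$-Stirling number of the second kind (number of partitions of $\{1,\dots,n+s\}$ into $k+s$ nonempty blocks with $1,\dots,s$ in distinct blocks), and $\phi_{n,s}(x)=\sum_{k=0}^n{n+s\brace k+s}_s x^k$ are the $s$-exponential polynomials. $d_{k,r}$ is the number of permutations of a $k$-set with exactly $r$ fixed points ($d_{k,r}=\binom{k}{r}d_{k-r}$ for $k\ge r$, $0$ otherwise, $d_m=m!\sum_{i=0}^m(-1)^i/i!$), and $\tilde{w}_{n,r}(y)=\sum_{k=0}^n{n\brace k}d_{k,r}y^k$. -}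

module Defs where

open import Data.Nat as ℕ using (ℕ; zero; suc; _!; _∸_; _<ᵇ_)
open import Data.Nat.Properties using (_!≢0)
open import Data.Nat.Combinatorics using (_C_)
open import Data.Bool using (if_then_else_)
open import Data.Integer using (+_)
open import Data.Rational using (ℚ; 0ℚ; 1ℚ; _+_; _*_; _-_; -_; _/_)

ι : ℕ → ℚ
ι n = (+ n) / 1

_^ℚ_ : ℚ → ℕ → ℚ
x ^ℚ zero  = 1ℚ
x ^ℚ suc n = x * (x ^ℚ n)

sumTo : ℕ → (ℕ → ℚ) → ℚ
sumTo zero    f = f 0
sumTo (suc n) f = sumTo n f + f (suc n)

inv! : ℕ → ℚ
inv! r = ((+ 1) / (r !)) {{r !≢0}}

S2 : ℕ → ℕ → ℕ
S2 zero    zero    = 1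
S2 zero    (suc k) = 0
S2 (suc n) zero    = 0
S2 (suc n) (suc k) = suc k ℕ.* S2 n (suc k) ℕ.+ S2 n k

-- sS s n k = {n+s brace k+s}_s  (s-Stirling numbers of the second kind),
-- via the standard recurrence (insert element n+s+1 as a new singleton block,
-- or into one of the k+s existing blocks).
sS : ℕ → ℕ → ℕ → ℕ
sS s zero    zero    = 1
sS s zero    (suc k) = 0
sS s (suc n) zero    = s ℕ.* sS s n zero
sS s (suc n) (suc k) = (suc k ℕ.+ s) ℕ.* sS s n (suc k) ℕ.+ sS s n k

φ : ℕ → ℕ → ℚ → ℚ
φ n s x = sumTo n (λ k → ι (sS s n k) * (x ^ℚ k))

der : ℕ → ℚ
der m = ι (m !) * sumTo m (λ i → ((- 1ℚ) ^ℚ i) * inv! i)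

dkr : ℕ → ℕ → ℚ
dkr k r = if k <ᵇ r then 0ℚ else ι (k C r) * der (k ∸ r)

w̃ : ℕ → ℕ → ℚ → ℚ
w̃ n r y = sumTo n (λ k → ι (S2 n k) * dkr k r * (y ^ℚ k))

-- The recurrence d_{m+1} = (m+1) d_m + (-1)^{m+1} and the
-- identity (r+1) C(k,r+1) = (k-r) C(k,r) give d_{k,r} - (r+1) d_{k,r+1} = C(k,r) (-1)^{k-r}
-- for k ≥ r (and 0 for k < r), so the left side is Σ_k {n brace k} C(k,r) (-1)^{k-r} y^k.
-- On the right, Σ_i (-1)^{r-i} C(r,i) g(i) is the r-th forward difference of g at 0. The
-- recurrence {n+s+1 brace k+s+1}_{s+1} = {n+s brace k+s}_s + (k+1) {n+s brace k+s+1}_s says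
-- that one difference in s turns the coefficient of x^k into (k+1) times that of x^{k+1};
-- iterating, the coefficient of x^k in the r-th difference of φ_{n,s}(x) at s = 0 is
-- r! C(r+k,r) {n brace r+k}. With x = -y both sides become the same sum.
module Submission where

open import Defs
open import Data.Bool using (true; false; if_then_else_; T)
open import Data.Bool.Properties using (T-≡)
open import Data.Nat as ℕ using (ℕ; zero; suc; _∸_; _!; _<ᵇ_)
import Data.Nat.Properties as ℕ
import Data.Nat.Tactic.RingSolver as ℕ-Solver
import Data.Nat.Coprimality as Coprime
open import Data.Nat.Combinatorics using (_C_; nC1≡n; k>n⇒nCk≡0; nCk+nC[k+1]≡[n+1]C[k+1])
import Data.Integer as ℤ
import Data.Integer.Properties as ℤ
open import Data.Rational using (ℚ; mkℚ; 0ℚ; 1ℚ; _+_; _*_; _-_; -_; _/_; _≟_)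
import Data.Rational.Properties as ℚ
open import Function using (_∘_; Equivalence)
open import Level using (0ℓ)
open import Relation.Binary.PropositionalEquality
  using (_≡_; refl; sym; trans; cong; cong₂; subst; module ≡-Reasoning)
open import Relation.Nullary using (contradiction)
open import Relation.Nullary.Decidable using (dec⇒maybe)
open import Tactic.RingSolver using (solve-∀)
open import Tactic.RingSolver.Core.AlmostCommutativeRing
  using (AlmostCommutativeRing; fromCommutativeRing)

open ≡-Reasoning

ℚ-ring : AlmostCommutativeRing 0ℓ 0ℓ
ℚ-ring = fromCommutativeRing ℚ.+-*-commutativeRing (λ p → dec⇒maybe (0ℚ ≟ p))

-- ι n is stuck on a gcd for variable n; in this normal form, arithmetic on casts computes.
ι≡mkℚ : ∀ n → ι n ≡ mkℚ (ℤ.+ n) 0 (Coprime.sym (Coprime.1-coprimeTo n))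
ι≡mkℚ n = ℚ.↥p/↧p≡p (mkℚ (ℤ.+ n) 0 _)

ι-homo-+ : ∀ m n → ι (m ℕ.+ n) ≡ ι m + ι n
ι-homo-+ m n rewrite ι≡mkℚ m | ι≡mkℚ n =
  ℚ./-cong (sym (cong₂ ℤ._+_ (ℤ.*-identityʳ (ℤ.+ m)) (ℤ.*-identityʳ (ℤ.+ n)))) refl

ι-homo-* : ∀ m n → ι (m ℕ.* n) ≡ ι m * ι n
ι-homo-* m n rewrite ι≡mkℚ m | ι≡mkℚ n = ℚ./-cong (ℤ.pos-* m n) refl

ι-*-≡ : ∀ a b c d → a ℕ.* b ≡ c ℕ.* d → ι a * ι b ≡ ι c * ι d
ι-*-≡ a b c d eq = trans (sym (ι-homo-* a b)) (trans (cong ι eq) (ι-homo-* c d))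

ι-inverseʳ : ∀ d .{{_ : ℕ.NonZero d}} → ι d * (ℤ.+ 1 / d) ≡ 1ℚ
ι-inverseʳ d@(suc d-1) rewrite ι≡mkℚ d =
  trans (cong (ι′ *_) (ℚ.↥p/↧p≡p (mkℚ (ℤ.+ 1) d-1 (Coprime.1-coprimeTo d)))) (ℚ.*-inverseʳ ι′)
  where
  ι′ = mkℚ (ℤ.+ d) 0 (Coprime.sym (Coprime.1-coprimeTo d))

sumTo-cong : ∀ n {f g : ℕ → ℚ} → (∀ k → k ℕ.≤ n → f k ≡ g k) → sumTo n f ≡ sumTo n g
sumTo-cong zero    f≗g = f≗g 0 ℕ.z≤n
sumTo-cong (suc n) f≗g =
  cong₂ _+_ (sumTo-cong n (λ k k≤n → f≗g k (ℕ.m≤n⇒m≤1+n k≤n))) (f≗g (suc n) ℕ.≤-refl)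

sumTo-+ : ∀ n (f g : ℕ → ℚ) → sumTo n (λ k → f k + g k) ≡ sumTo n f + sumTo n g
sumTo-+ zero    f g = refl
sumTo-+ (suc n) f g =
  trans (cong (_+ (f (suc n) + g (suc n))) (sumTo-+ n f g))
        (interchange (sumTo n f) (sumTo n g) (f (suc n)) (g (suc n)))
  where
  interchange : ∀ a b c d → (a + b) + (c + d) ≡ (a + c) + (b + d)
  interchange = solve-∀ ℚ-ring

sumTo-neg : ∀ n (f : ℕ → ℚ) → sumTo n (λ k → - f k) ≡ - sumTo n f
sumTo-neg zero    f = refl
sumTo-neg (suc n) f =
  trans (cong (_- f (suc n)) (sumTo-neg n f)) (sym (ℚ.neg-distrib-+ (sumTo n f) (f (suc n))))

sumTo-- : ∀ n (f g : ℕ → ℚ) → sumTo n (λ k → f k - g k) ≡ sumTo n f - sumTo n g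
sumTo-- n f g = trans (sumTo-+ n f (-_ ∘ g)) (cong (sumTo n f +_) (sumTo-neg n g))

*-distribˡ-sumTo : ∀ n c (f : ℕ → ℚ) → c * sumTo n f ≡ sumTo n (λ k → c * f k)
*-distribˡ-sumTo zero    c f = refl
*-distribˡ-sumTo (suc n) c f =
  trans (ℚ.*-distribˡ-+ c (sumTo n f) (f (suc n)))
        (cong (_+ c * f (suc n)) (*-distribˡ-sumTo n c f))

sumTo-suc : ∀ n (f : ℕ → ℚ) → sumTo (suc n) f ≡ f 0 + sumTo n (f ∘ suc)
sumTo-suc zero    f = refl
sumTo-suc (suc n) f =
  trans (cong (_+ f (suc (suc n))) (sumTo-suc n f)) (ℚ.+-assoc (f 0) _ _)

sumTo-suc-vanishing : ∀ n (f : ℕ → ℚ) → f (suc n) ≡ 0ℚ → sumTo (suc n) f ≡ sumTo n f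
sumTo-suc-vanishing n f fₙ₊₁≡0 =
  trans (cong (sumTo n f +_) fₙ₊₁≡0) (ℚ.+-identityʳ (sumTo n f))

sumTo-shift : ∀ n (f : ℕ → ℚ) → f 0 ≡ 0ℚ → f (suc n) ≡ 0ℚ → sumTo n f ≡ sumTo n (f ∘ suc)
sumTo-shift n f f₀≡0 fₙ₊₁≡0 = begin
  sumTo n f                ≡⟨ sumTo-suc-vanishing n f fₙ₊₁≡0 ⟨
  sumTo (suc n) f          ≡⟨ sumTo-suc n f ⟩
  f 0 + sumTo n (f ∘ suc)  ≡⟨ cong (_+ sumTo n (f ∘ suc)) f₀≡0 ⟩
  0ℚ + sumTo n (f ∘ suc)   ≡⟨ ℚ.+-identityˡ (sumTo n (f ∘ suc)) ⟩
  sumTo n (f ∘ suc)        ∎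

sumTo-shift-by : ∀ r n (f : ℕ → ℚ) →
                 (∀ k → k ℕ.< r → f k ≡ 0ℚ) → (∀ k → n ℕ.< k → f k ≡ 0ℚ) →
                 sumTo n f ≡ sumTo n (λ k → f (r ℕ.+ k))
sumTo-shift-by zero    n f _     _     = refl
sumTo-shift-by (suc r) n f below above =
  trans (sumTo-shift n f (below 0 ℕ.z<s) (above (suc n) ℕ.≤-refl))
        (sumTo-shift-by r n (f ∘ suc) (λ k k<r → below (suc k) (ℕ.s<s k<r))
                                      (λ k n<k → above (suc k) (ℕ.m<n⇒m<1+n n<k)))

sumTo-pascal : ∀ r (g : ℕ → ℚ) →
  sumTo (suc r) (λ i → ι (suc r C i) * g i)
    ≡ sumTo r (λ i → ι (r C i) * g (suc i)) + sumTo r (λ i → ι (r C i) * g i)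
sumTo-pascal r g = begin
  sumTo (suc r) (λ i → ι (suc r C i) * g i)
    ≡⟨ sumTo-suc r _ ⟩
  G 0 + sumTo r (λ i → ι (suc r C suc i) * g (suc i))
    ≡⟨ cong (G 0 +_) (trans (sumTo-cong r (λ i _ → pascal i)) (sumTo-+ r A B)) ⟩
  G 0 + (sumTo r A + sumTo r B)
    ≡⟨ swap (G 0) (sumTo r A) (sumTo r B) ⟩
  sumTo r A + (G 0 + sumTo r B)
    ≡⟨ cong (sumTo r A +_) (sumTo-suc r G) ⟨
  sumTo r A + sumTo (suc r) G
    ≡⟨ cong (sumTo r A +_) (sumTo-suc-vanishing r G top) ⟩
  sumTo r A + sumTo r G ∎
  where
  A B G : ℕ → ℚ
  A i = ι (r C i) * g (suc i)
  B i = ι (r C suc i) * g (suc i)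
  G i = ι (r C i) * g i
  pascal : ∀ i → ι (suc r C suc i) * g (suc i) ≡ A i + B i
  pascal i = trans (cong (λ c → ι c * g (suc i)) (sym (nCk+nC[k+1]≡[n+1]C[k+1] r i)))
                   (trans (cong (_* g (suc i)) (ι-homo-+ (r C i) (r C suc i)))
                          (ℚ.*-distribʳ-+ (g (suc i)) (ι (r C i)) (ι (r C suc i))))
  top : G (suc r) ≡ 0ℚ
  top = trans (cong (λ c → ι c * g (suc r)) (k>n⇒nCk≡0 (ℕ.n<1+n r))) (ℚ.*-zeroˡ (g (suc r)))
  swap : ∀ a b c → a + (b + c) ≡ b + (a + c)
  swap = solve-∀ ℚ-ring

^ℚ-distribˡ-+-* : ∀ x m n → x ^ℚ (m ℕ.+ n) ≡ (x ^ℚ m) * (x ^ℚ n)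
^ℚ-distribˡ-+-* x zero    n = sym (ℚ.*-identityˡ (x ^ℚ n))
^ℚ-distribˡ-+-* x (suc m) n =
  trans (cong (x *_) (^ℚ-distribˡ-+-* x m n)) (sym (ℚ.*-assoc x (x ^ℚ m) (x ^ℚ n)))

-‿^ℚ : ∀ x n → (- x) ^ℚ n ≡ ((- 1ℚ) ^ℚ n) * (x ^ℚ n)
-‿^ℚ x zero    = refl
-‿^ℚ x (suc n) = trans (cong ((- x) *_) (-‿^ℚ x n)) (regroup x ((- 1ℚ) ^ℚ n) (x ^ℚ n))
  where
  regroup : ∀ x s p → (- x) * (s * p) ≡ (- 1ℚ * s) * (x * p)
  regroup = solve-∀ ℚ-ring

[k+1]*[n+1]C[k+1]≡[n+1]*nCk : ∀ n k → suc k ℕ.* (suc n C suc k) ≡ suc n ℕ.* (n C k)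
[k+1]*[n+1]C[k+1]≡[n+1]*nCk zero    zero    = refl
[k+1]*[n+1]C[k+1]≡[n+1]*nCk zero    (suc k) = ℕ.*-zeroʳ (suc (suc k))
[k+1]*[n+1]C[k+1]≡[n+1]*nCk (suc n) zero    =
  trans (ℕ.*-identityˡ (suc (suc n) C 1))
        (trans (nC1≡n (suc (suc n))) (sym (ℕ.*-identityʳ (suc (suc n)))))
[k+1]*[n+1]C[k+1]≡[n+1]*nCk (suc n) (suc k) = begin
  suc (suc k) ℕ.* (suc (suc n) C suc (suc k))
    ≡⟨ cong (suc (suc k) ℕ.*_) (nCk+nC[k+1]≡[n+1]C[k+1] (suc n) (suc k)) ⟨
  suc (suc k) ℕ.* (a ℕ.+ b)
    ≡⟨ split k a b ⟩
  a ℕ.+ suc k ℕ.* a ℕ.+ suc (suc k) ℕ.* b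
    ≡⟨ cong₂ (λ u v → a ℕ.+ u ℕ.+ v) ([k+1]*[n+1]C[k+1]≡[n+1]*nCk n k)
                                     ([k+1]*[n+1]C[k+1]≡[n+1]*nCk n (suc k)) ⟩
  a ℕ.+ suc n ℕ.* (n C k) ℕ.+ suc n ℕ.* (n C suc k)
    ≡⟨ ℕ.+-assoc a _ _ ⟩
  a ℕ.+ (suc n ℕ.* (n C k) ℕ.+ suc n ℕ.* (n C suc k))
    ≡⟨ cong (a ℕ.+_) (ℕ.*-distribˡ-+ (suc n) (n C k) (n C suc k)) ⟨
  a ℕ.+ suc n ℕ.* (n C k ℕ.+ n C suc k)
    ≡⟨ cong (λ c → a ℕ.+ suc n ℕ.* c) (nCk+nC[k+1]≡[n+1]C[k+1] n k) ⟩
  suc (suc n) ℕ.* a ∎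
  where
  a = suc n C suc k
  b = suc n C suc (suc k)
  split : ∀ k a b → suc (suc k) ℕ.* (a ℕ.+ b) ≡ a ℕ.+ suc k ℕ.* a ℕ.+ suc (suc k) ℕ.* b
  split = ℕ-Solver.solve-∀

[r+1]*[r+j+1]C[r+1]≡[j+1]*[r+j+1]Cr : ∀ r j →
  suc r ℕ.* ((r ℕ.+ suc j) C suc r) ≡ suc j ℕ.* ((r ℕ.+ suc j) C r)
[r+1]*[r+j+1]C[r+1]≡[j+1]*[r+j+1]Cr r j = ℕ.+-cancelˡ-≡ (suc r ℕ.* (m C r)) _ _ (begin
  suc r ℕ.* (m C r) ℕ.+ suc r ℕ.* (m C suc r)  ≡⟨ ℕ.*-distribˡ-+ (suc r) (m C r) (m C suc r) ⟨
  suc r ℕ.* (m C r ℕ.+ m C suc r)              ≡⟨ cong (suc r ℕ.*_) (nCk+nC[k+1]≡[n+1]C[k+1] m r) ⟩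
  suc r ℕ.* (suc m C suc r)                    ≡⟨ [k+1]*[n+1]C[k+1]≡[n+1]*nCk m r ⟩
  suc m ℕ.* (m C r)                            ≡⟨ ℕ.*-distribʳ-+ (m C r) (suc r) (suc j) ⟩
  suc r ℕ.* (m C r) ℕ.+ suc j ℕ.* (m C r)      ∎)
  where
  m = r ℕ.+ suc j

k>n⇒S2nk≡0 : ∀ {n k} → n ℕ.< k → S2 n k ≡ 0
k>n⇒S2nk≡0 {zero}  {suc k} _            = refl
k>n⇒S2nk≡0 {suc n} {suc k} (ℕ.s<s n<k) =
  cong₂ ℕ._+_ (trans (cong (suc k ℕ.*_) (k>n⇒S2nk≡0 (ℕ.m<n⇒m<1+n n<k))) (ℕ.*-zeroʳ (suc k)))
              (k>n⇒S2nk≡0 n<k)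

sS0≡S2 : ∀ n k → sS 0 n k ≡ S2 n k
sS0≡S2 zero    zero    = refl
sS0≡S2 zero    (suc k) = refl
sS0≡S2 (suc n) zero    = refl
sS0≡S2 (suc n) (suc k) =
  cong₂ ℕ._+_ (cong₂ ℕ._*_ (ℕ.+-identityʳ (suc k)) (sS0≡S2 n (suc k))) (sS0≡S2 n k)

sS-suc : ∀ s n k → sS (suc s) n k ≡ sS s n k ℕ.+ suc k ℕ.* sS s n (suc k)
sS-suc s zero    zero    = refl
sS-suc s zero    (suc k) = sym (ℕ.*-zeroʳ (suc (suc k)))
sS-suc s (suc n) zero    =
  trans (cong (suc s ℕ.*_) (sS-suc s n 0)) (recurrence s (sS s n 0) (sS s n 1))
  where
  recurrence : ∀ s a b → suc s ℕ.* (a ℕ.+ 1 ℕ.* b) ≡ s ℕ.* a ℕ.+ 1 ℕ.* ((1 ℕ.+ s) ℕ.* b ℕ.+ a)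
  recurrence = ℕ-Solver.solve-∀
sS-suc s (suc n) (suc k) =
  trans (cong₂ (λ u v → (suc k ℕ.+ suc s) ℕ.* u ℕ.+ v) (sS-suc s n (suc k)) (sS-suc s n k))
        (recurrence s k (sS s n k) (sS s n (suc k)) (sS s n (suc (suc k))))
  where
  recurrence : ∀ s k a b c →
    (suc k ℕ.+ suc s) ℕ.* (b ℕ.+ suc (suc k) ℕ.* c) ℕ.+ (a ℕ.+ suc k ℕ.* b)
      ≡ ((suc k ℕ.+ s) ℕ.* b ℕ.+ a) ℕ.+ suc (suc k) ℕ.* ((suc (suc k) ℕ.+ s) ℕ.* c ℕ.+ b)
  recurrence = ℕ-Solver.solve-∀

Δ : ℕ → (ℕ → ℚ) → ℕ → ℚ
Δ zero    f s = f s
Δ (suc r) f s = Δ r f (suc s) - Δ r f s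

Δ-sumTo : ∀ r n (g : ℕ → ℕ → ℚ) s →
          Δ r (λ t → sumTo n (g t)) s ≡ sumTo n (λ k → Δ r (λ t → g t k) s)
Δ-sumTo zero    n g s = refl
Δ-sumTo (suc r) n g s =
  trans (cong₂ _-_ (Δ-sumTo r n g (suc s)) (Δ-sumTo r n g s)) (sym (sumTo-- n _ _))

Δ-*ʳ : ∀ r (f : ℕ → ℚ) c s → Δ r (λ t → f t * c) s ≡ Δ r f s * c
Δ-*ʳ zero    f c s = refl
Δ-*ʳ (suc r) f c s =
  trans (cong₂ _-_ (Δ-*ʳ r f c (suc s)) (Δ-*ʳ r f c s)) (*-distribʳ-- c (Δ r f (suc s)) (Δ r f s))
  where
  *-distribʳ-- : ∀ c a b → a * c - b * c ≡ (a - b) * c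
  *-distribʳ-- = solve-∀ ℚ-ring

alternatingSum≡Δ : ∀ r (f : ℕ → ℚ) s →
  sumTo r (λ i → ((- 1ℚ) ^ℚ (r ∸ i)) * ι (r C i) * f (s ℕ.+ i)) ≡ Δ r f s
alternatingSum≡Δ zero    f s = trans (ℚ.*-identityˡ (f (s ℕ.+ 0))) (cong f (ℕ.+-identityʳ s))
alternatingSum≡Δ (suc r) f s = begin
  sumTo (suc r) (λ i → σ (suc r ∸ i) * ι (suc r C i) * f (s ℕ.+ i))
    ≡⟨ sumTo-cong (suc r) (λ i _ → swap (σ (suc r ∸ i)) (ι (suc r C i)) (f (s ℕ.+ i))) ⟩
  sumTo (suc r) (λ i → ι (suc r C i) * g i)
    ≡⟨ sumTo-pascal r g ⟩
  sumTo r (λ i → ι (r C i) * g (suc i)) + sumTo r (λ i → ι (r C i) * g i)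
    ≡⟨ cong₂ _+_ (sumTo-cong r (λ i _ → upper i)) (trans (sumTo-cong r lower) (sumTo-neg r _)) ⟩
  sumTo r (λ i → σ (r ∸ i) * ι (r C i) * f (suc s ℕ.+ i))
    - sumTo r (λ i → σ (r ∸ i) * ι (r C i) * f (s ℕ.+ i))
    ≡⟨ cong₂ _-_ (alternatingSum≡Δ r f (suc s)) (alternatingSum≡Δ r f s) ⟩
  Δ r f (suc s) - Δ r f s ∎
  where
  σ g : ℕ → ℚ
  σ k = (- 1ℚ) ^ℚ k
  g i = σ (suc r ∸ i) * f (s ℕ.+ i)
  swap : ∀ a b c → a * b * c ≡ b * (a * c)
  swap = solve-∀ ℚ-ring
  flip-sign : ∀ a b c → b * ((- 1ℚ * a) * c) ≡ - (a * b * c)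
  flip-sign = solve-∀ ℚ-ring
  upper : ∀ i → ι (r C i) * g (suc i) ≡ σ (r ∸ i) * ι (r C i) * f (suc s ℕ.+ i)
  upper i = trans (sym (swap (σ (r ∸ i)) (ι (r C i)) (f (s ℕ.+ suc i))))
                  (cong (λ m → σ (r ∸ i) * ι (r C i) * f m) (ℕ.+-suc s i))
  lower : ∀ i → i ℕ.≤ r → ι (r C i) * g i ≡ - (σ (r ∸ i) * ι (r C i) * f (s ℕ.+ i))
  lower i i≤r = trans (cong (λ m → ι (r C i) * (σ m * f (s ℕ.+ i))) (ℕ.+-∸-assoc 1 i≤r))
                      (flip-sign (σ (r ∸ i)) (ι (r C i)) (f (s ℕ.+ i)))

Δ-sS : ∀ r n k s →
  Δ r (λ t → ι (sS t n k)) s ≡ ι (r !) * ι ((r ℕ.+ k) C r) * ι (sS s n (r ℕ.+ k))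
Δ-sS zero    n k s = sym (ℚ.*-identityˡ (ι (sS s n k)))
Δ-sS (suc r) n k s = begin
  Δ r F (suc s) - Δ r F s
    ≡⟨ cong₂ _-_ (Δ-sS r n k (suc s)) (Δ-sS r n k s) ⟩
  R * B * ι (sS (suc s) n m) - R * B * ι (sS s n m)
    ≡⟨ cong (λ z → R * B * z - R * B * ι (sS s n m)) ι-sS-suc ⟩
  R * B * (ι (sS s n m) + ι (suc m) * X) - R * B * ι (sS s n m)
    ≡⟨ cancel R B (ι (sS s n m)) (ι (suc m)) X ⟩
  R * (ι (suc m) * B) * X
    ≡⟨ cong (λ z → R * z * X) (ι-*-≡ (suc m) (m C r) (suc r) (suc m C suc r)
                                      (sym ([k+1]*[n+1]C[k+1]≡[n+1]*nCk m r))) ⟩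
  R * (ι (suc r) * B′) * X
    ≡⟨ regroup R (ι (suc r)) B′ X ⟩
  ι (suc r) * R * B′ * X
    ≡⟨ cong (λ z → z * B′ * X) (ι-homo-* (suc r) (r !)) ⟨
  ι (suc r !) * B′ * X ∎
  where
  F : ℕ → ℚ
  F t = ι (sS t n k)
  m = r ℕ.+ k
  R = ι (r !)
  B = ι (m C r)
  B′ = ι (suc m C suc r)
  X = ι (sS s n (suc m))
  ι-sS-suc : ι (sS (suc s) n m) ≡ ι (sS s n m) + ι (suc m) * X
  ι-sS-suc = begin
    ι (sS (suc s) n m)
      ≡⟨ cong ι (sS-suc s n m) ⟩
    ι (sS s n m ℕ.+ suc m ℕ.* sS s n (suc m))
      ≡⟨ ι-homo-+ (sS s n m) (suc m ℕ.* sS s n (suc m)) ⟩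
    ι (sS s n m) + ι (suc m ℕ.* sS s n (suc m))
      ≡⟨ cong (ι (sS s n m) +_) (ι-homo-* (suc m) (sS s n (suc m))) ⟩
    ι (sS s n m) + ι (suc m) * X ∎
  cancel : ∀ R B a c X → R * B * (a + c * X) - R * B * a ≡ R * (c * B) * X
  cancel = solve-∀ ℚ-ring
  regroup : ∀ R c B X → R * (c * B) * X ≡ c * R * B * X
  regroup = solve-∀ ℚ-ring

der-suc : ∀ j → der (suc j) ≡ ι (suc j) * der j + (- 1ℚ) ^ℚ suc j
der-suc j = begin
  ι (suc j !) * (S + σ * inv! (suc j))
    ≡⟨ distrib (ι (suc j !)) S σ (inv! (suc j)) ⟩
  ι (suc j !) * S + σ * (ι (suc j !) * inv! (suc j))
    ≡⟨ cong₂ (λ a b → a * S + σ * b) (ι-homo-* (suc j) (j !))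
                                     (ι-inverseʳ (suc j !) {{suc j ℕ.!≢0}}) ⟩
  ι (suc j) * ι (j !) * S + σ * 1ℚ
    ≡⟨ regroup (ι (suc j)) (ι (j !)) S σ ⟩
  ι (suc j) * (ι (j !) * S) + σ ∎
  where
  S = sumTo j (λ i → ((- 1ℚ) ^ℚ i) * inv! i)
  σ = (- 1ℚ) ^ℚ suc j
  distrib : ∀ q s σ i → q * (s + σ * i) ≡ q * s + σ * (q * i)
  distrib = solve-∀ ℚ-ring
  regroup : ∀ a b s σ → a * b * s + σ * 1ℚ ≡ a * (b * s) + σ
  regroup = solve-∀ ℚ-ring

dkr-< : ∀ {k r} → k ℕ.< r → dkr k r ≡ 0ℚ
dkr-< {k} {r} k<r =
  cong (λ b → if b then 0ℚ else ι (k C r) * der (k ∸ r)) (Equivalence.to T-≡ (ℕ.<⇒<ᵇ k<r))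

dkr-+ : ∀ {k} r j → k ≡ r ℕ.+ j → dkr k r ≡ ι (k C r) * der j
dkr-+ r j refl with r ℕ.+ j <ᵇ r in eq
... | true  = contradiction (ℕ.<ᵇ⇒< (r ℕ.+ j) r (subst T (sym eq) _)) (ℕ.m+n≮m r j)
... | false = cong (λ m → ι ((r ℕ.+ j) C r) * der m) (ℕ.m+n∸m≡n r j)

dkr-difference : ∀ r j →
  dkr (r ℕ.+ j) r - ι (suc r) * dkr (r ℕ.+ j) (suc r) ≡ ι ((r ℕ.+ j) C r) * (- 1ℚ) ^ℚ j
dkr-difference r zero =
  trans (cong₂ (λ d d′ → d - ι (suc r) * d′)
               (dkr-+ r 0 refl) (dkr-< (ℕ.s≤s (ℕ.≤-reflexive (ℕ.+-identityʳ r)))))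
        (drop-zero (ι ((r ℕ.+ 0) C r)) (ι (suc r)))
  where
  drop-zero : ∀ b c → b * 1ℚ - c * 0ℚ ≡ b * 1ℚ
  drop-zero = solve-∀ ℚ-ring
dkr-difference r (suc j) = begin
  dkr k r - c * dkr k (suc r)
    ≡⟨ cong₂ (λ d d′ → d - c * d′) (dkr-+ r (suc j) refl) (dkr-+ (suc r) j (ℕ.+-suc r j)) ⟩
  B * der (suc j) - c * (B′ * der j)
    ≡⟨ cong (λ d → B * d - c * (B′ * der j)) (der-suc j) ⟩
  B * (ι (suc j) * der j + σ) - c * (B′ * der j)
    ≡⟨ regroup B (ι (suc j)) (der j) σ c B′ ⟩
  B * (ι (suc j) * der j + σ) - c * B′ * der j
    ≡⟨ cong (λ z → B * (ι (suc j) * der j + σ) - z * der j)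
            (ι-*-≡ (suc r) (k C suc r) (suc j) (k C r)
                   ([r+1]*[r+j+1]C[r+1]≡[j+1]*[r+j+1]Cr r j)) ⟩
  B * (ι (suc j) * der j + σ) - ι (suc j) * B * der j
    ≡⟨ cancel B (ι (suc j)) (der j) σ ⟩
  B * σ ∎
  where
  k = r ℕ.+ suc j
  c = ι (suc r)
  B = ι (k C r)
  B′ = ι (k C suc r)
  σ = (- 1ℚ) ^ℚ suc j
  regroup : ∀ B a d σ c B′ → B * (a * d + σ) - c * (B′ * d) ≡ B * (a * d + σ) - c * B′ * d
  regroup = solve-∀ ℚ-ring
  cancel : ∀ B a d σ → B * (a * d + σ) - a * B * d ≡ B * σ
  cancel = solve-∀ ℚ-ring

w̃-difference : ∀ n r y →
  w̃ n r y - ι (suc r) * w̃ n (suc r) y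
    ≡ (y ^ℚ r) * sumTo n (λ j → ι ((r ℕ.+ j) C r) * ι (S2 n (r ℕ.+ j)) * ((- y) ^ℚ j))
w̃-difference n r y = begin
  w̃ n r y - c * w̃ n (suc r) y
    ≡⟨ cong (λ z → w̃ n r y - z) (*-distribˡ-sumTo n c b) ⟩
  sumTo n a - sumTo n (λ k → c * b k)
    ≡⟨ sumTo-- n a (λ k → c * b k) ⟨
  sumTo n (λ k → a k - c * b k)
    ≡⟨ sumTo-cong n (λ k _ → factor (ι (S2 n k)) (dkr k r) (dkr k (suc r)) (y ^ℚ k) c) ⟩
  sumTo n F
    ≡⟨ sumTo-shift-by r n F below above ⟩
  sumTo n (λ j → F (r ℕ.+ j))
    ≡⟨ sumTo-cong n (λ j _ → shifted j) ⟩
  sumTo n (λ j → y ^ℚ r * term j)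
    ≡⟨ *-distribˡ-sumTo n (y ^ℚ r) term ⟨
  y ^ℚ r * sumTo n term ∎
  where
  c = ι (suc r)
  a b D F term : ℕ → ℚ
  a k = ι (S2 n k) * dkr k r * (y ^ℚ k)
  b k = ι (S2 n k) * dkr k (suc r) * (y ^ℚ k)
  D k = dkr k r - c * dkr k (suc r)
  F k = ι (S2 n k) * D k * (y ^ℚ k)
  term j = ι ((r ℕ.+ j) C r) * ι (S2 n (r ℕ.+ j)) * ((- y) ^ℚ j)
  factor : ∀ s d d′ x c → s * d * x - c * (s * d′ * x) ≡ s * (d - c * d′) * x
  factor = solve-∀ ℚ-ring
  vanish : ∀ s c x → s * (0ℚ - c * 0ℚ) * x ≡ 0ℚ
  vanish = solve-∀ ℚ-ring
  below : ∀ k → k ℕ.< r → F k ≡ 0ℚ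
  below k k<r = trans (cong₂ (λ d d′ → ι (S2 n k) * (d - c * d′) * (y ^ℚ k))
                             (dkr-< k<r) (dkr-< (ℕ.m<n⇒m<1+n k<r)))
                      (vanish (ι (S2 n k)) c (y ^ℚ k))
  above : ∀ k → n ℕ.< k → F k ≡ 0ℚ
  above k n<k = trans (cong (λ m → ι m * D k * (y ^ℚ k)) (k>n⇒S2nk≡0 n<k))
                      (trans (cong (_* (y ^ℚ k)) (ℚ.*-zeroˡ (D k))) (ℚ.*-zeroˡ (y ^ℚ k)))
  regroup : ∀ s b σ p q → s * (b * σ) * (p * q) ≡ p * (b * s * (σ * q))
  regroup = solve-∀ ℚ-ring
  shifted : ∀ j → F (r ℕ.+ j) ≡ y ^ℚ r * term j
  shifted j = begin
    ι S * D (r ℕ.+ j) * (y ^ℚ (r ℕ.+ j))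
      ≡⟨ cong₂ (λ d p → ι S * d * p) (dkr-difference r j) (^ℚ-distribˡ-+-* y r j) ⟩
    ι S * (ι B * (- 1ℚ) ^ℚ j) * (y ^ℚ r * y ^ℚ j)
      ≡⟨ regroup (ι S) (ι B) ((- 1ℚ) ^ℚ j) (y ^ℚ r) (y ^ℚ j) ⟩
    y ^ℚ r * (ι B * ι S * ((- 1ℚ) ^ℚ j * y ^ℚ j))
      ≡⟨ cong (λ p → y ^ℚ r * (ι B * ι S * p)) (-‿^ℚ y j) ⟨
    y ^ℚ r * term j ∎
    where
    S = S2 n (r ℕ.+ j)
    B = (r ℕ.+ j) C r

alternatingSum-φ : ∀ n r x →
  sumTo r (λ i → ((- 1ℚ) ^ℚ (r ∸ i)) * ι (r C i) * φ n i x)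
    ≡ ι (r !) * sumTo n (λ j → ι ((r ℕ.+ j) C r) * ι (S2 n (r ℕ.+ j)) * (x ^ℚ j))
alternatingSum-φ n r x = begin
  sumTo r (λ i → ((- 1ℚ) ^ℚ (r ∸ i)) * ι (r C i) * φ n i x)
    ≡⟨ alternatingSum≡Δ r (λ s → φ n s x) 0 ⟩
  Δ r (λ s → φ n s x) 0
    ≡⟨ Δ-sumTo r n (λ s k → ι (sS s n k) * (x ^ℚ k)) 0 ⟩
  sumTo n (λ k → Δ r (λ s → ι (sS s n k) * (x ^ℚ k)) 0)
    ≡⟨ sumTo-cong n (λ k _ → coefficient k) ⟩
  sumTo n (λ k → ι (r !) * term k)
    ≡⟨ *-distribˡ-sumTo n (ι (r !)) term ⟨
  ι (r !) * sumTo n term ∎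
  where
  term : ℕ → ℚ
  term k = ι ((r ℕ.+ k) C r) * ι (S2 n (r ℕ.+ k)) * (x ^ℚ k)
  assoc : ∀ a b c d → a * b * c * d ≡ a * (b * c * d)
  assoc = solve-∀ ℚ-ring
  coefficient : ∀ k → Δ r (λ s → ι (sS s n k) * (x ^ℚ k)) 0 ≡ ι (r !) * term k
  coefficient k = begin
    Δ r (λ s → ι (sS s n k) * (x ^ℚ k)) 0
      ≡⟨ Δ-*ʳ r (λ s → ι (sS s n k)) (x ^ℚ k) 0 ⟩
    Δ r (λ s → ι (sS s n k)) 0 * (x ^ℚ k)
      ≡⟨ cong (_* (x ^ℚ k)) (Δ-sS r n k 0) ⟩
    ι (r !) * B * ι (sS 0 n (r ℕ.+ k)) * (x ^ℚ k)
      ≡⟨ cong (λ m → ι (r !) * B * ι m * (x ^ℚ k)) (sS0≡S2 n (r ℕ.+ k)) ⟩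
    ι (r !) * B * ι (S2 n (r ℕ.+ k)) * (x ^ℚ k)
      ≡⟨ assoc (ι (r !)) B (ι (S2 n (r ℕ.+ k))) (x ^ℚ k) ⟩
    ι (r !) * term k ∎
    where
    B = ι ((r ℕ.+ k) C r)

mainTheorem10 : (n r : ℕ) (y : ℚ) →
    w̃ n r y - ι (suc r) * w̃ n (suc r) y
      ≡ ((y ^ℚ r) * inv! r)
          * sumTo r (λ i → ((- 1ℚ) ^ℚ (r ∸ i)) * ι (r C i) * φ n i (- y))
mainTheorem10 n r y = begin
  w̃ n r y - ι (suc r) * w̃ n (suc r) y
    ≡⟨ w̃-difference n r y ⟩
  y ^ℚ r * Σ
    ≡⟨ ℚ.*-identityʳ (y ^ℚ r * Σ) ⟨
  y ^ℚ r * Σ * 1ℚ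
    ≡⟨ cong (y ^ℚ r * Σ *_) (ι-inverseʳ (r !) {{r ℕ.!≢0}}) ⟨
  y ^ℚ r * Σ * (ι (r !) * inv! r)
    ≡⟨ regroup (y ^ℚ r) Σ (ι (r !)) (inv! r) ⟩
  y ^ℚ r * inv! r * (ι (r !) * Σ)
    ≡⟨ cong (y ^ℚ r * inv! r *_) (alternatingSum-φ n r (- y)) ⟨
  y ^ℚ r * inv! r * sumTo r (λ i → ((- 1ℚ) ^ℚ (r ∸ i)) * ι (r C i) * φ n i (- y)) ∎
  where
  Σ = sumTo n (λ j → ι ((r ℕ.+ j) C r) * ι (S2 n (r ℕ.+ j)) * ((- y) ^ℚ j))
  regroup : ∀ p s f i → p * s * (f * i) ≡ p * i * (f * s)
  regroup = solve-∀ ℚ-ring
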